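{- Let $S$ be a modal Kleene algebra and $a\in S$. Then $(\mathrm{nrm}\,a)(\mathrm{nrm}\,a)=\mathrm{nrm}\,a$.
   Context: An idempotent semiring is a structure $(S,+,\cdot,0,1)$ such that $(S,+,0)$ is a commutative monoid with $a+a=a$, $(S,\cdot,1)$ is a monoid, multiplication distributes over addition from both sides, and $0a=a0=0$; natural order $a\le b\iff a+b=b$. A test is an element $p\le 1$ for which some $q$ satisfies $p+q=1$ and $pq=0=qp$; $q$ is unique, written $\neg p$; tests form a Boolean algebra $\mathrm{test}(S)$. $S$ is a modal semiring if for each $a\in S$ there are maps $|a\rangle,\langle a|$ on $\mathrm{test}(S)$ with, for all $a,b,p,q$: $|a\rangle p\le q\iff \neg q\,a\,p\le 0$; $\langle a|p\le q\iff p\,a\,\neg q\le 0$; $|ab\rangle p=|a\rangle(|b\rangle p)$; $\langle ab|p=\langle b|(\langle a|p)$. Domain: $\mathrm{dom}\,a=|a\rangle1$. A Kleene algebra is an idempotent semiring with ${}^*$ such that $1+aa^*\le a^*$, $b+ac\le c\Rightarrow a^*b\le c$, $1+a^*a\le a^*$, $b+ca\le c\Rightarrow ba^*\le c$; a modal Kleene algebra is a Kleene algebra that is a modal semiring. The normaliser of $a$ is $\mathrm{nrm}\,a=a^*\,\neg\mathrm{dom}\,a$. -}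

module Defs where

open import Level using (Level; suc; _⊔_)
open import Data.Product using (Σ; _×_; _,_; proj₁; proj₂)
open import Relation.Binary.PropositionalEquality using (_≡_)
open import Function.Bundles using (_⇔_)

record ModalKleeneAlgebra (c : Level) : Set (suc c) where
  infixl 6 _+_
  infixl 7 _·_
  infix 4 _≤_
  field
    S   : Set c
    _+_ : S → S → S
    _·_ : S → S → S
    0#  : S
    1#  : S
    _⋆  : S → S
    +-assoc : ∀ a b c → (a + b) + c ≡ a + (b + c)
    +-comm  : ∀ a b → a + b ≡ b + a
    +-idˡ   : ∀ a → 0# + a ≡ a
    +-idem  : ∀ a → a + a ≡ a
    ·-assoc : ∀ a b c → (a · b) · c ≡ a · (b · c)
    ·-idˡ   : ∀ a → 1# · a ≡ a
    ·-idʳ   : ∀ a → a · 1# ≡ a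
    distribˡ : ∀ a b c → a · (b + c) ≡ a · b + a · c
    distribʳ : ∀ a b c → (b + c) · a ≡ b · a + c · a
    zeroˡ    : ∀ a → 0# · a ≡ 0#
    zeroʳ    : ∀ a → a · 0# ≡ 0#

  _≤_ : S → S → Set c
  a ≤ b = a + b ≡ b

  field
    ⋆-unfoldˡ : ∀ a → 1# + a · (a ⋆) ≤ a ⋆
    ⋆-inductˡ : ∀ a b c → b + a · c ≤ c → (a ⋆) · b ≤ c
    ⋆-unfoldʳ : ∀ a → 1# + (a ⋆) · a ≤ a ⋆
    ⋆-inductʳ : ∀ a b c → b + c · a ≤ c → b · (a ⋆) ≤ c

  IsComplement : S → S → Set c
  IsComplement p q = (p + q ≡ 1#) × (p · q ≡ 0#) × (q · p ≡ 0#)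

  IsTest : S → Set c
  IsTest p = (p ≤ 1#) × Σ S (IsComplement p)

  Test : Set c
  Test = Σ S IsTest

  neg : Test → S
  neg (_ , _ , q , _) = q

  field
    fdia : S → Test → Test
    bdia : S → Test → Test
    fdia-galois : ∀ a (p q : Test) →
      (proj₁ (fdia a p) ≤ proj₁ q) ⇔ (neg q · a · proj₁ p ≤ 0#)
    bdia-galois : ∀ a (p q : Test) →
      (proj₁ (bdia a p) ≤ proj₁ q) ⇔ (proj₁ p · a · neg q ≤ 0#)
    fdia-comp : ∀ a b (p : Test) →
      proj₁ (fdia (a · b) p) ≡ proj₁ (fdia a (fdia b p))
    bdia-comp : ∀ a b (p : Test) →
      proj₁ (bdia (a · b) p) ≡ proj₁ (bdia b (bdia a p))

  oneTest : Test
  oneTest = 1# , +-idem 1# , 0# , (Eq.trans (+-comm 1# 0#) (+-idˡ 1#)) , ·-idˡ 0# , zeroˡ 1#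
    where import Relation.Binary.PropositionalEquality as Eq

  dom : S → Test
  dom a = fdia a oneTest

  nrm : S → S
  nrm a = (a ⋆) · neg (dom a)

module Submission where

-- Write n = ¬dom a. The proof rests on three general facts.
--   * The complement of a test is idempotent: q · q = q · (p + q) = q · 1 = q.
--   * n annihilates a on the left: n · a ≤ 0 is exactly what the Galois
--     connection of the forward diamond says about dom a ≤ dom a.
--   * Star absorption: whenever q · a = 0 we get q · a⋆ = q; the inequality
--     q · a⋆ ≤ q is star induction, and q ≤ q · a⋆ follows from 1 ≤ a⋆.
-- Hence nrm a · nrm a = a⋆ · (n · a⋆) · n = a⋆ · n · n = a⋆ · n = nrm a.

open import Defs
open import Relation.Binary.PropositionalEquality using (_≡_; sym; trans; cong)
import Relation.Binary.PropositionalEquality as Eq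
open import Data.Product using (_,_; proj₂)
open import Function.Bundles using (Equivalence)

module NormaliserProof {c} (K : ModalKleeneAlgebra c) where
  open ModalKleeneAlgebra K
  open Eq.≡-Reasoning

  +-idʳ : ∀ x → x + 0# ≡ x
  +-idʳ x = trans (+-comm x 0#) (+-idˡ x)

  ≤0⇒≡0 : ∀ {x} → x ≤ 0# → x ≡ 0#
  ≤0⇒≡0 {x} x≤0 = trans (sym (+-idʳ x)) x≤0

  ≤-antisym : ∀ {x y} → x ≤ y → y ≤ x → x ≡ y
  ≤-antisym {x} {y} x≤y y≤x = trans (sym y≤x) (trans (+-comm y x) x≤y)

  +-≤⇒ˡ-≤ : ∀ {x y z} → x + y ≤ z → x ≤ z
  +-≤⇒ˡ-≤ {x} {y} {z} x+y≤z = begin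
    x + z             ≡⟨ cong (x +_) (sym x+y≤z) ⟩
    x + ((x + y) + z) ≡⟨ cong (x +_) (+-assoc x y z) ⟩
    x + (x + (y + z)) ≡⟨ sym (+-assoc x x (y + z)) ⟩
    (x + x) + (y + z) ≡⟨ cong (_+ (y + z)) (+-idem x) ⟩
    x + (y + z)       ≡⟨ sym (+-assoc x y z) ⟩
    (x + y) + z       ≡⟨ x+y≤z ⟩
    z                 ∎

  ·-monoʳ-≤ : ∀ z {x y} → x ≤ y → z · x ≤ z · y
  ·-monoʳ-≤ z {x} {y} x≤y = trans (sym (distribˡ z x y)) (cong (z ·_) x≤y)

  1≤⋆ : ∀ a → 1# ≤ a ⋆
  1≤⋆ a = +-≤⇒ˡ-≤ (⋆-unfoldˡ a)

  complement-idem : ∀ {p q} → IsComplement p q → q · q ≡ q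
  complement-idem {p} {q} (p+q≡1 , _ , qp≡0) = begin
    q · q          ≡⟨ sym (+-idˡ _) ⟩
    0# + q · q     ≡⟨ cong (_+ q · q) (sym qp≡0) ⟩
    q · p + q · q  ≡⟨ sym (distribˡ q p q) ⟩
    q · (p + q)    ≡⟨ cong (q ·_) p+q≡1 ⟩
    q · 1#         ≡⟨ ·-idʳ q ⟩
    q              ∎

  -- ¬dom a annihilates a from the left: the Galois connection for |a⟩
  -- turns dom a ≤ dom a into ¬dom a · a · 1 ≤ 0.
  ¬dom-annihilates : ∀ a → neg (dom a) · a ≡ 0#
  ¬dom-annihilates a = trans (sym (·-idʳ _))
    (≤0⇒≡0 (Equivalence.to (fdia-galois a oneTest (dom a)) (+-idem _)))

  annihilator-absorbs-⋆ : ∀ {q a} → q · a ≡ 0# → q · (a ⋆) ≡ q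
  annihilator-absorbs-⋆ {q} {a} qa≡0 = ≤-antisym qa⋆≤q q≤qa⋆
    where
    qa⋆≤q : q · (a ⋆) ≤ q
    qa⋆≤q = ⋆-inductʳ a q q (begin
      (q + q · a) + q ≡⟨ cong (λ z → (q + z) + q) qa≡0 ⟩
      (q + 0#) + q    ≡⟨ cong (_+ q) (+-idʳ q) ⟩
      q + q           ≡⟨ +-idem q ⟩
      q               ∎)

    q≤qa⋆ : q ≤ q · (a ⋆)
    q≤qa⋆ = Eq.subst (λ z → z ≤ q · (a ⋆)) (·-idʳ q) (·-monoʳ-≤ q (1≤⋆ a))

  nrm-idem : ∀ a → nrm a · nrm a ≡ nrm a
  nrm-idem a = begin
    (a ⋆ · n) · (a ⋆ · n) ≡⟨ ·-assoc (a ⋆) n _ ⟩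
    a ⋆ · (n · (a ⋆ · n)) ≡⟨ cong (a ⋆ ·_) (sym (·-assoc n (a ⋆) n)) ⟩
    a ⋆ · ((n · a ⋆) · n) ≡⟨ cong (λ z → a ⋆ · (z · n))
                                  (annihilator-absorbs-⋆ (¬dom-annihilates a)) ⟩
    a ⋆ · (n · n)         ≡⟨ cong (a ⋆ ·_) (complement-idem (proj₂ (proj₂ (proj₂ (dom a))))) ⟩
    a ⋆ · n               ∎
    where
    n : S
    n = neg (dom a)

lemma9p3 : ∀ {c} (K : ModalKleeneAlgebra c) (a : ModalKleeneAlgebra.S K) →
    let open ModalKleeneAlgebra K in nrm a · nrm a ≡ nrm a
lemma9p3 K a = NormaliserProof.nrm-idem K a
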